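{- Let $G=(V,E)$ be a finite simple undirected graph, $k$ a positive integer, $S\subseteq V$ a $k$-plex of $G$, and $C\subseteq V\setminus S$. Let $I\subseteq C$ and let $UB$ be an upper bound on the number of vertices that $I$ can provide for $S$. Let $v\in C$ be a vertex adjacent to at most $UB-\delta_k^{ - }(S,v)$ vertices of $I$. Then $UB$ is an upper bound on the number of vertices that $I\cup\{v\}$ can provide for $S$.
   Context: For $v\in V$, $N(v)$ denotes the set of vertices adjacent to $v$ (so $v\notin N(v)$). A set $S\subseteq V$ is a $k$-plex if every $v\in S$ satisfies $|S\setminus N(v)|\le k$. For $v\in V$, $\delta(S,v)=|S\setminus N(v)|$ and $\delta_k^{ - }(S,v)=k-\delta(S,v)$. The "number of vertices that a set $J\subseteq C$ can provide for $S$" means $\max\{|T| : T\subseteq J,\ S\cup T \text{ is a } k\text{ -plex}\}$; an upper bound on it is any number $\ge$ this maximum. -}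

module Defs where

open import Data.Nat using (ℕ; _≤_)
open import Data.Integer using (ℤ; +_; _-_)
open import Data.Bool using (Bool; true; false)
open import Data.Fin using (Fin)
open import Data.Fin.Subset using (Subset; _∈_; _─_; ∣_∣)
open import Data.Vec using (tabulate)
open import Relation.Binary.PropositionalEquality using (_≡_)

record Graph (n : ℕ) : Set where
  field
    adj     : Fin n → Fin n → Bool
    adj-sym : ∀ u v → adj u v ≡ adj v u
    adj-irr : ∀ v → adj v v ≡ false

module _ {n : ℕ} (G : Graph n) where
  open Graph G

  N : Fin n → Subset n
  N v = tabulate (λ u → adj v u)

  δ : Subset n → Fin n → ℕ
  δ S v = ∣ S ─ N v ∣

  δ⁻ : ℕ → Subset n → Fin n → ℤ
  δ⁻ k S v = + k - + δ S v

  IsKPlex : ℕ → Subset n → Set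
  IsKPlex k S = ∀ v → v ∈ S → δ S v ≤ k

  -- UB is an upper bound on the number of vertices that J can provide for S:
  -- every T ⊆ J with S ∪ T a k-plex has |T| ≤ UB.
  IsProvideUB : ℕ → Subset n → Subset n → ℕ → Set
  IsProvideUB k S J UB =
    ∀ (T : Subset n) → (∀ x → x ∈ T → x ∈ J) → IsKPlex k (S Data.Fin.Subset.∪ T) → ∣ T ∣ ≤ UB

-- Let T ⊆ I ∪ {v} with S ∪ T a k-plex. If v ∉ T, then T ⊆ I and the bound for
-- I applies. If v ∈ T, split T into its neighbours of v, which lie in N(v) ∩ I,
-- and its non-neighbours, which (T ⊆ C being disjoint from S) contribute
-- exactly |T \ N(v)| to the non-neighbourhood count:
-- δ(S ∪ T, v) = δ(S, v) + |T \ N(v)|.  Hence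
--   |T| + δ(S, v) ≤ |N(v) ∩ I| + δ(S ∪ T, v) ≤ |N(v) ∩ I| + k ≤ UB + δ(S, v),
-- the middle step because S ∪ T is a k-plex containing v.
module Submission where

open import Defs
open import Data.Nat using (ℕ; suc; _+_; _≤_; _≥_)
open import Data.Nat.Properties
  using (+-suc; +-assoc; +-comm; +-identityʳ; +-monoˡ-≤; +-monoʳ-≤; +-cancelʳ-≤; module ≤-Reasoning)
import Data.Integer as ℤ
import Data.Integer.Properties as ℤ
open import Data.Integer.Tactic.RingSolver using (solve-∀)
open import Data.Fin using (Fin)
open import Data.Fin.Subset
  using (Subset; inside; outside; _∈_; _∉_; _⊆_; _∪_; _∩_; _─_; ⁅_⁆; ∣_∣; ⊥; Empty)
open import Data.Fin.Subset.Properties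
  using (_∈?_; x∈p∩q⁺; x∈p∩q⁻; x∈p∪q⁺; x∈p∪q⁻; x∈⁅y⁆⇒x≡y; p─q⊆p; p⊆q⇒∣p∣≤∣q∣; Empty-unique; ∣⊥∣≡0)
open import Data.Vec using ([]; _∷_)
open import Data.Vec.Properties using ([]=⇒lookup; lookup∘tabulate)
open import Data.Product using (_,_)
open import Data.Sum using (inj₁; inj₂)
open import Data.Empty using (⊥-elim)
open import Relation.Nullary using (yes; no)
open import Relation.Binary.PropositionalEquality

∣p∣≡∣p∩q∣+∣p─q∣ : ∀ {n} (p q : Subset n) → ∣ p ∣ ≡ ∣ p ∩ q ∣ + ∣ p ─ q ∣
∣p∣≡∣p∩q∣+∣p─q∣ []            []            = refl
∣p∣≡∣p∩q∣+∣p─q∣ (outside ∷ p) (outside ∷ q) = ∣p∣≡∣p∩q∣+∣p─q∣ p q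
∣p∣≡∣p∩q∣+∣p─q∣ (outside ∷ p) (inside  ∷ q) = ∣p∣≡∣p∩q∣+∣p─q∣ p q
∣p∣≡∣p∩q∣+∣p─q∣ (inside  ∷ p) (inside  ∷ q) = cong suc (∣p∣≡∣p∩q∣+∣p─q∣ p q)
∣p∣≡∣p∩q∣+∣p─q∣ (inside  ∷ p) (outside ∷ q) =
  trans (cong suc (∣p∣≡∣p∩q∣+∣p─q∣ p q)) (sym (+-suc ∣ p ∩ q ∣ ∣ p ─ q ∣))

∣p∪q∣+∣p∩q∣≡∣p∣+∣q∣ : ∀ {n} (p q : Subset n) → ∣ p ∪ q ∣ + ∣ p ∩ q ∣ ≡ ∣ p ∣ + ∣ q ∣
∣p∪q∣+∣p∩q∣≡∣p∣+∣q∣ []            []            = refl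
∣p∪q∣+∣p∩q∣≡∣p∣+∣q∣ (outside ∷ p) (outside ∷ q) = ∣p∪q∣+∣p∩q∣≡∣p∣+∣q∣ p q
∣p∪q∣+∣p∩q∣≡∣p∣+∣q∣ (outside ∷ p) (inside  ∷ q) =
  trans (cong suc (∣p∪q∣+∣p∩q∣≡∣p∣+∣q∣ p q)) (sym (+-suc ∣ p ∣ ∣ q ∣))
∣p∪q∣+∣p∩q∣≡∣p∣+∣q∣ (inside  ∷ p) (outside ∷ q) = cong suc (∣p∪q∣+∣p∩q∣≡∣p∣+∣q∣ p q)
∣p∪q∣+∣p∩q∣≡∣p∣+∣q∣ (inside  ∷ p) (inside  ∷ q) = cong suc (begin
  ∣ p ∪ q ∣ + suc ∣ p ∩ q ∣  ≡⟨ +-suc ∣ p ∪ q ∣ ∣ p ∩ q ∣ ⟩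
  suc (∣ p ∪ q ∣ + ∣ p ∩ q ∣) ≡⟨ cong suc (∣p∪q∣+∣p∩q∣≡∣p∣+∣q∣ p q) ⟩
  suc (∣ p ∣ + ∣ q ∣)         ≡⟨ +-suc ∣ p ∣ ∣ q ∣ ⟨
  ∣ p ∣ + suc ∣ q ∣           ∎)
  where open ≡-Reasoning

Empty-p∩q⇒∣p∪q∣≡∣p∣+∣q∣ : ∀ {n} (p q : Subset n) → Empty (p ∩ q) → ∣ p ∪ q ∣ ≡ ∣ p ∣ + ∣ q ∣
Empty-p∩q⇒∣p∪q∣≡∣p∣+∣q∣ {n} p q p∩q-empty = begin
  ∣ p ∪ q ∣               ≡⟨ +-identityʳ ∣ p ∪ q ∣ ⟨
  ∣ p ∪ q ∣ + 0           ≡⟨ cong (∣ p ∪ q ∣ +_) (∣⊥∣≡0 n) ⟨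
  ∣ p ∪ q ∣ + ∣ ⊥ {n} ∣   ≡⟨ cong (λ r → ∣ p ∪ q ∣ + ∣ r ∣) (Empty-unique p∩q-empty) ⟨
  ∣ p ∪ q ∣ + ∣ p ∩ q ∣   ≡⟨ ∣p∪q∣+∣p∩q∣≡∣p∣+∣q∣ p q ⟩
  ∣ p ∣ + ∣ q ∣           ∎
  where open ≡-Reasoning

─-distribʳ-∪ : ∀ {n} (p q r : Subset n) → (p ∪ q) ─ r ≡ (p ─ r) ∪ (q ─ r)
─-distribʳ-∪ []      []      []            = refl
─-distribʳ-∪ (s ∷ p) (t ∷ q) (outside ∷ r) = cong (_ ∷_) (─-distribʳ-∪ p q r)
─-distribʳ-∪ (s ∷ p) (t ∷ q) (inside  ∷ r) = cong (outside ∷_) (─-distribʳ-∪ p q r)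

p⊆q∪⁅x⁆∧x∉p⇒p⊆q : ∀ {n} {p q : Subset n} {x} → p ⊆ q ∪ ⁅ x ⁆ → x ∉ p → p ⊆ q
p⊆q∪⁅x⁆∧x∉p⇒p⊆q {q = q} {x} p⊆q∪x x∉p {y} y∈p with x∈p∪q⁻ q ⁅ x ⁆ (p⊆q∪x y∈p)
... | inj₁ y∈q = y∈q
... | inj₂ y∈x = ⊥-elim (x∉p (subst (_∈ _) (x∈⁅y⁆⇒x≡y x y∈x) y∈p))

module _ {n} (G : Graph n) where

  x∉N[x] : ∀ x → x ∉ N G x
  x∉N[x] x x∈N[x]
    with trans (sym (Graph.adj-irr G x)) (trans (sym (lookup∘tabulate _ x)) ([]=⇒lookup x∈N[x]))
  ... | ()

  δ-∪ : ∀ S T v → Empty (S ∩ T) → δ G (S ∪ T) v ≡ δ G S v + ∣ T ─ N G v ∣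
  δ-∪ S T v S∩T-empty = begin
    ∣ (S ∪ T) ─ N G v ∣                ≡⟨ cong ∣_∣ (─-distribʳ-∪ S T (N G v)) ⟩
    ∣ (S ─ N G v) ∪ (T ─ N G v) ∣      ≡⟨ Empty-p∩q⇒∣p∪q∣≡∣p∣+∣q∣ _ _ differences-disjoint ⟩
    ∣ S ─ N G v ∣ + ∣ T ─ N G v ∣      ∎
    where
    open ≡-Reasoning
    differences-disjoint : Empty ((S ─ N G v) ∩ (T ─ N G v))
    differences-disjoint (x , x∈both) with x∈p∩q⁻ (S ─ N G v) (T ─ N G v) x∈both
    ... | x∈S─N , x∈T─N = S∩T-empty (x , x∈p∩q⁺ (p─q⊆p S _ x∈S─N , p─q⊆p T _ x∈T─N))

  ∣T∣+δ[S]≤∣N∩I∣+δ[S∪T] : ∀ S T I v → T ⊆ I ∪ ⁅ v ⁆ → Empty (S ∩ T) →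
                          ∣ T ∣ + δ G S v ≤ ∣ N G v ∩ I ∣ + δ G (S ∪ T) v
  ∣T∣+δ[S]≤∣N∩I∣+δ[S∪T] S T I v T⊆I∪v S∩T-empty = begin
    ∣ T ∣ + δ G S v                                   ≡⟨ cong (_+ δ G S v) (∣p∣≡∣p∩q∣+∣p─q∣ T (N G v)) ⟩
    ∣ T ∩ N G v ∣ + ∣ T ─ N G v ∣ + δ G S v           ≤⟨ +-monoˡ-≤ _ (+-monoˡ-≤ _ (p⊆q⇒∣p∣≤∣q∣ T∩N⊆N∩I)) ⟩
    ∣ N G v ∩ I ∣ + ∣ T ─ N G v ∣ + δ G S v           ≡⟨ +-assoc ∣ N G v ∩ I ∣ _ _ ⟩
    ∣ N G v ∩ I ∣ + (∣ T ─ N G v ∣ + δ G S v)         ≡⟨ cong (∣ N G v ∩ I ∣ +_) (+-comm ∣ T ─ N G v ∣ _) ⟩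
    ∣ N G v ∩ I ∣ + (δ G S v + ∣ T ─ N G v ∣)         ≡⟨ cong (∣ N G v ∩ I ∣ +_) (δ-∪ S T v S∩T-empty) ⟨
    ∣ N G v ∩ I ∣ + δ G (S ∪ T) v                     ∎
    where
    open ≤-Reasoning
    T∩N⊆N∩I : T ∩ N G v ⊆ N G v ∩ I
    T∩N⊆N∩I x∈T∩N with x∈p∩q⁻ T (N G v) x∈T∩N
    ... | x∈T , x∈N with x∈p∪q⁻ I ⁅ v ⁆ (T⊆I∪v x∈T)
    ...   | inj₁ x∈I = x∈p∩q⁺ (x∈N , x∈I)
    ...   | inj₂ x∈v = ⊥-elim (x∉N[x] v (subst (_∈ N G v) (x∈⁅y⁆⇒x≡y v x∈v) x∈N))

-- Opened only here: the prefix +_ makes ℕ sections such as (∣ p ∣ +_) ambiguous.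
open import Data.Integer using (+_; _-_)

+m≤+n-[+k-+d]⇒m+k≤n+d : ∀ {m n k d} → + m ℤ.≤ + n - (+ k - + d) → m + k ≤ n + d
+m≤+n-[+k-+d]⇒m+k≤n+d {m} {n} {k} {d} h = ℤ.drop‿+≤+ (begin
  + m ℤ.+ + k                                   ≡⟨ add-difference (+ m) (+ k) (+ d) ⟨
  + m ℤ.+ (+ k - + d) ℤ.+ + d                   ≤⟨ ℤ.+-monoˡ-≤ (+ d) (ℤ.+-monoˡ-≤ (+ k - + d) h) ⟩
  + n - (+ k - + d) ℤ.+ (+ k - + d) ℤ.+ + d     ≡⟨ subtract-add (+ n) (+ k - + d) (+ d) ⟩
  + n ℤ.+ + d                                   ∎)
  where
  open ℤ.≤-Reasoning
  add-difference : ∀ a b c → a ℤ.+ (b - c) ℤ.+ c ≡ a ℤ.+ b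
  add-difference = solve-∀
  subtract-add : ∀ a b c → a - b ℤ.+ b ℤ.+ c ≡ a ℤ.+ c
  subtract-add = solve-∀

lemma3 : {n : ℕ} (G : Graph n) (k : ℕ) → k ≥ 1 →
    (S C I : Subset n) →
    IsKPlex G k S →
    (∀ x → x ∈ C → x ∉ S) →
    (∀ x → x ∈ I → x ∈ C) →
    (UB : ℕ) → IsProvideUB G k S I UB →
    (v : Fin n) → v ∈ C →
    (+ ∣ N G v ∩ I ∣) ℤ.≤ (+ UB) - δ⁻ G k S v →
    IsProvideUB G k S (I ∪ ⁅ v ⁆) UB
lemma3 G k _ S C I _ C∩S-empty I⊆C UB I-bounded v v∈C few-neighbours T T⊆I∪v S∪T-plex with v ∈? T
... | no v∉T = I-bounded T (λ _ → p⊆q∪⁅x⁆∧x∉p⇒p⊆q (T⊆I∪v _) v∉T) S∪T-plex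
... | yes v∈T = +-cancelʳ-≤ (δ G S v) ∣ T ∣ UB (begin
  ∣ T ∣ + δ G S v                 ≤⟨ ∣T∣+δ[S]≤∣N∩I∣+δ[S∪T] G S T I v (T⊆I∪v _) S∩T-empty ⟩
  ∣ N G v ∩ I ∣ + δ G (S ∪ T) v   ≤⟨ +-monoʳ-≤ ∣ N G v ∩ I ∣ (S∪T-plex v (x∈p∪q⁺ (inj₂ v∈T))) ⟩
  ∣ N G v ∩ I ∣ + k               ≤⟨ +m≤+n-[+k-+d]⇒m+k≤n+d {n = UB} {d = δ G S v} few-neighbours ⟩
  UB + δ G S v                    ∎)
  where
  open ≤-Reasoning
  S∩T-empty : Empty (S ∩ T)
  S∩T-empty (x , x∈S∩T) with x∈p∩q⁻ S T x∈S∩T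
  ... | x∈S , x∈T with x∈p∪q⁻ I ⁅ v ⁆ (T⊆I∪v _ x∈T)
  ...   | inj₁ x∈I = C∩S-empty x (I⊆C x x∈I) x∈S
  ...   | inj₂ x∈v = C∩S-empty v v∈C (subst (_∈ S) (x∈⁅y⁆⇒x≡y v x∈v) x∈S)
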